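{- Let $k$ and $r$ be positive integers with $k\geq 2$ and $1\leq r<k-1$, such that $r$ does not divide $k-1$. Let $D$ be the diameter of $K(2k+r,k)$ and suppose $D=2p+1$ for an integer $p\geq 1$. If $A$ and $B$ are two distinct vertices of $K_{=2p+1}(2k+r,k)$ which are not adjacent, then their distance in $K_{=2p+1}(2k+r,k)$ is $2$.
   Context: For positive integers $n,k$, $[n]^k$ is the set of $k$-element subsets of $\{1,\dots,n\}$. The Kneser graph $K(2k+r,k)$ has vertex set $[2k+r]^k$, with $A,B$ adjacent iff $A\cap B=\emptyset$; it is connected. For a connected graph $G$ and positive integer $d$, the exact distance-$d$ graph $G_{=d}$ has the same vertex set as $G$, with two vertices adjacent iff their distance in $G$ is exactly $d$. $K_{=d}(2k+r,k)$ denotes the exact distance-$d$ graph of $K(2k+r,k)$. (The diameter of $K(2k+r,k)$ is $\lceil (k-1)/r\rceil+1$.) -}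

module Defs where

open import Level using (0ℓ)
open import Data.Nat using (ℕ; zero; suc; _+_; _*_; _≤_; _<_)
open import Data.Fin.Subset using (Subset; _∩_; ⊥; ∣_∣)
open import Data.Product using (Σ; _×_; _,_; ∃; proj₁)
open import Relation.Binary.PropositionalEquality using (_≡_)
open import Relation.Nullary using (¬_)

data Walk {V : Set} (Adj : V → V → Set) : ℕ → V → V → Set where
  nil  : ∀ {x} → Walk Adj zero x x
  cons : ∀ {n x y z} → Adj x y → Walk Adj n y z → Walk Adj (suc n) x z

Dist : {V : Set} → (V → V → Set) → V → V → ℕ → Set
Dist Adj x y d = Walk Adj d x y × (∀ m → m < d → ¬ Walk Adj m x y)

ExactDistAdj : {V : Set} → (V → V → Set) → ℕ → V → V → Set
ExactDistAdj Adj d x y = Dist Adj x y d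

Diameter : {V : Set} → (V → V → Set) → ℕ → Set
Diameter {V} Adj D =
  (∀ (x y : V) → Σ ℕ (λ m → m ≤ D × Dist Adj x y m))
  × Σ V (λ x → Σ V (λ y → Dist Adj x y D))

KVertex : ℕ → ℕ → Set
KVertex n k = Σ (Subset n) (λ A → ∣ A ∣ ≡ k)

KAdj : ∀ {n k} → KVertex n k → KVertex n k → Set
KAdj A B = (proj₁ A ∩ proj₁ B) ≡ ⊥

-- In K(2k + r, k) write s = |X ∩ Y| and d = |X ∖ Y| = k − s.  A neighbour W of X lies in the
-- complement of X, so |X ∩ Y| ≤ |W ∖ Y| and |X ∖ Y| ≤ r + |W ∩ Y|, and both bounds are attained.
-- Hence X and Y are joined by a walk of length 2j iff d ≤ j r, and by one of length 2j + 1 iff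
-- s ≤ j r.  For D = 2q + 3 the pairs at distance D are therefore those with q r < s and
-- (q + 1) r < d, and the existence of one such pair leaves room 2 q r + r + 2 ≤ k.  This room is
-- what is needed to choose, for arbitrary A and B, a k-set C that meets A and B in the
-- same number t of elements with q r < t and (q + 1) r < k − t; then C is at distance D from both.
module Submission where

open import Defs
open import Data.Empty using (⊥-elim)
open import Data.Fin.Subset using (Subset; _∩_; ∁; ∣_∣; _⊆_; _∈_; inside; outside) renaming (⊥ to ∅)
open import Data.Fin.Subset.Properties
  using (∉⊥; x∈p∩q⁺; x∈p∩q⁻; x∉p⇒x∈∁p; x∉∁p⇒x∈p; ⊆-antisym; p⊆q⇒∣p∣≤∣q∣; ∣⊥∣≡0; ∣∁p∣≡n∸∣p∣; ∩-comm; ∩-inverseʳ)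
open import Data.Nat using (ℕ; zero; suc; _≤?_; _+_; _*_; _∸_; _≤_; _<_; z≤n; s≤s; _≤′_; ≤′-refl; ≤′-step; ⌊_/2⌋)
open import Data.Nat.Divisibility using (_∣_)
open import Data.Nat.Properties
open import Algebra.Properties.CommutativeSemigroup +-commutativeSemigroup using (x∙yz≈z∙yx; x∙yz≈xz∙y)
open import Data.Nat.Tactic.RingSolver using (solve-∀)
open import Data.Product using (Σ; ∃; _×_; _,_; proj₁)
open import Data.Product.Function.NonDependent.Propositional using (_×-⇔_)
open import Data.Sum using (_⊎_; inj₁; inj₂; [_,_])
open import Data.Vec using ([]; _∷_)
open import Function using (_∘_; id; _⇔_; mk⇔; Equivalence)
open import Relation.Binary.PropositionalEquality
  using (_≡_; refl; sym; trans; cong; subst; subst₂; module ≡-Reasoning)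
open import Relation.Nullary using (¬_; yes; no)

private
  variable
    n : ℕ
    p q s : Subset n

∣p∩q∣+∣p∩∁q∣≡∣p∣ : (p q : Subset n) → ∣ p ∩ q ∣ + ∣ p ∩ ∁ q ∣ ≡ ∣ p ∣
∣p∩q∣+∣p∩∁q∣≡∣p∣ []            []            = refl
∣p∩q∣+∣p∩∁q∣≡∣p∣ (inside  ∷ p) (inside  ∷ q) = cong suc (∣p∩q∣+∣p∩∁q∣≡∣p∣ p q)
∣p∩q∣+∣p∩∁q∣≡∣p∣ (inside  ∷ p) (outside ∷ q) = trans (+-suc _ _) (cong suc (∣p∩q∣+∣p∩∁q∣≡∣p∣ p q))
∣p∩q∣+∣p∩∁q∣≡∣p∣ (outside ∷ p) (_       ∷ q) = ∣p∩q∣+∣p∩∁q∣≡∣p∣ p q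

∣p∣≡0⇒p≡∅ : (p : Subset n) → ∣ p ∣ ≡ 0 → p ≡ ∅
∣p∣≡0⇒p≡∅ []            _   = refl
∣p∣≡0⇒p≡∅ (outside ∷ p) ∣p∣≡0 = cong (outside ∷_) (∣p∣≡0⇒p≡∅ p ∣p∣≡0)

p∩q≡∅⇒p⊆∁q : p ∩ q ≡ ∅ → p ⊆ ∁ q
p∩q≡∅⇒p⊆∁q p∩q≡∅ x∈p = x∉p⇒x∈∁p λ x∈q → ∉⊥ (subst (_ ∈_) p∩q≡∅ (x∈p∩q⁺ (x∈p , x∈q)))

p∩∁q≡∅⇒p⊆q : p ∩ ∁ q ≡ ∅ → p ⊆ q
p∩∁q≡∅⇒p⊆q p∩∁q≡∅ x∈p = x∉∁p⇒x∈p λ x∈∁q → ∉⊥ (subst (_ ∈_) p∩∁q≡∅ (x∈p∩q⁺ (x∈p , x∈∁q)))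

p⊆q⇒p∩s⊆q∩s : p ⊆ q → p ∩ s ⊆ q ∩ s
p⊆q⇒p∩s⊆q∩s {p = p} {s = s} p⊆q x∈p∩s with x∈p∩q⁻ p s x∈p∩s
... | x∈p , x∈s = x∈p∩q⁺ (p⊆q x∈p , x∈s)

selectByRegion : (X Y : Subset n) {a b c d : ℕ} →
  a ≤ ∣ X ∩ Y ∣ → b ≤ ∣ X ∩ ∁ Y ∣ → c ≤ ∣ ∁ X ∩ Y ∣ → d ≤ ∣ ∁ X ∩ ∁ Y ∣ →
  ∃ λ C → ∣ C ∣ ≡ a + b + c + d × ∣ C ∩ X ∣ ≡ a + b × ∣ C ∩ Y ∣ ≡ a + c
selectByRegion [] [] z≤n z≤n z≤n z≤n = [] , refl , refl , refl
selectByRegion (inside ∷ X) (inside ∷ Y) z≤n hb hc hd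
  with C , ∣C∣ , ∣C∩X∣ , ∣C∩Y∣ ← selectByRegion X Y z≤n hb hc hd
  = outside ∷ C , ∣C∣ , ∣C∩X∣ , ∣C∩Y∣
selectByRegion (inside ∷ X) (inside ∷ Y) (s≤s ha) hb hc hd
  with C , ∣C∣ , ∣C∩X∣ , ∣C∩Y∣ ← selectByRegion X Y ha hb hc hd
  = inside ∷ C , cong suc ∣C∣ , cong suc ∣C∩X∣ , cong suc ∣C∩Y∣
selectByRegion (inside ∷ X) (outside ∷ Y) ha z≤n hc hd
  with C , ∣C∣ , ∣C∩X∣ , ∣C∩Y∣ ← selectByRegion X Y ha z≤n hc hd
  = outside ∷ C , ∣C∣ , ∣C∩X∣ , ∣C∩Y∣
selectByRegion (inside ∷ X) (outside ∷ Y) {a} {suc b} {c} {d} ha (s≤s hb) hc hd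
  with C , ∣C∣ , ∣C∩X∣ , ∣C∩Y∣ ← selectByRegion X Y ha hb hc hd
  = inside ∷ C
  , trans (cong suc ∣C∣) (cong (λ m → m + c + d) (sym (+-suc a b)))
  , trans (cong suc ∣C∩X∣) (sym (+-suc a b))
  , ∣C∩Y∣
selectByRegion (outside ∷ X) (inside ∷ Y) ha hb z≤n hd
  with C , ∣C∣ , ∣C∩X∣ , ∣C∩Y∣ ← selectByRegion X Y ha hb z≤n hd
  = outside ∷ C , ∣C∣ , ∣C∩X∣ , ∣C∩Y∣
selectByRegion (outside ∷ X) (inside ∷ Y) {a} {b} {suc c} {d} ha hb (s≤s hc) hd
  with C , ∣C∣ , ∣C∩X∣ , ∣C∩Y∣ ← selectByRegion X Y ha hb hc hd
  = inside ∷ C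
  , trans (cong suc ∣C∣) (cong (_+ d) (sym (+-suc (a + b) c)))
  , ∣C∩X∣
  , trans (cong suc ∣C∩Y∣) (sym (+-suc a c))
selectByRegion (outside ∷ X) (outside ∷ Y) ha hb hc z≤n
  with C , ∣C∣ , ∣C∩X∣ , ∣C∩Y∣ ← selectByRegion X Y ha hb hc z≤n
  = outside ∷ C , ∣C∣ , ∣C∩X∣ , ∣C∩Y∣
selectByRegion (outside ∷ X) (outside ∷ Y) {a} {b} {c} {suc d} ha hb hc (s≤s hd)
  with C , ∣C∣ , ∣C∩X∣ , ∣C∩Y∣ ← selectByRegion X Y ha hb hc hd
  = inside ∷ C , trans (cong suc ∣C∣) (sym (+-suc (a + b + c) d)) , ∣C∩X∣ , ∣C∩Y∣

module _ {V : Set} {Adj : V → V → Set} where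

  Dist-two : ∀ {x y z} → ¬ x ≡ y → ¬ Adj x y → Adj x z → Adj z y → Dist Adj x y 2
  Dist-two {x} {y} x≢y ¬x~y x~z z~y = cons x~z (cons z~y nil) , shorter
    where
    shorter : ∀ m → m < 2 → ¬ Walk Adj m x y
    shorter zero          _ nil              = x≢y refl
    shorter (suc zero)    _ (cons x~y nil)   = ¬x~y x~y
    shorter (suc (suc m)) (s≤s (s≤s ()))

  module _ (pad : ∀ {m x y} → Walk Adj m x y → Walk Adj (suc (suc m)) x y) where

    padTo : ∀ {m n x y} → m ≤′ n → Walk Adj m x y → Walk Adj n x y ⊎ Walk Adj (suc n) x y
    padTo ≤′-refl        w = inj₁ w
    padTo (≤′-step m≤′n) w with padTo m≤′n w
    ... | inj₁ w′ = inj₂ (pad w′)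
    ... | inj₂ w′ = inj₁ w′

    walk≤∧noWalks⇒Dist : ∀ {m n x y} → m ≤ suc (suc n) → Walk Adj m x y →
      ¬ Walk Adj n x y → ¬ Walk Adj (suc n) x y → Dist Adj x y (suc (suc n))
    walk≤∧noWalks⇒Dist {m} {n} {x} {y} m≤ w ¬wₙ ¬wₙ₊₁ = walkAtD (≤⇒≤′ m≤) , λ m′ m′< → noWalk (≤⇒≤′ (≤-pred m′<))
      where
      noWalk : ∀ {m′} → m′ ≤′ suc n → ¬ Walk Adj m′ x y
      noWalk ≤′-refl          = ¬wₙ₊₁
      noWalk (≤′-step m′≤′n) = [ ¬wₙ , ¬wₙ₊₁ ] ∘ padTo m′≤′n
      walkAtD : m ≤′ suc (suc n) → Walk Adj (suc (suc n)) x y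
      walkAtD ≤′-refl = w
      walkAtD (≤′-step m≤′n) = [ ⊥-elim ∘ ¬wₙ₊₁ , id ] (padTo m≤′n w)

-- The sizes of the parts of a set C in the four regions cut out by k-sets A and B of
-- [2k + r] with |A ∩ B| = s: A ∩ B (s elements), A ∖ B and B ∖ A (d elements each, C takes the
-- same number from both) and the outside (r + s elements).  C then has s + d = k elements and
-- meets A and B in overlapSize elements each.
record BalancedSizes (s d r : ℕ) : Set where
  field
    inBoth inEach inNeither : ℕ
    inBoth≤    : inBoth ≤ s
    inEach≤    : inEach ≤ d
    inNeither≤ : inNeither ≤ r + s
    total      : inBoth + inEach + inEach + inNeither ≡ s + d

open BalancedSizes

overlapSize : ∀ {s d r} → BalancedSizes s d r → ℕ
overlapSize sizes = inBoth sizes + inEach sizes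

BalancedSizesStrictlyBetween : (s d r a : ℕ) → Set
BalancedSizesStrictlyBetween s d r a =
  Σ (BalancedSizes s d r) λ sizes → a < overlapSize sizes × overlapSize sizes + (r + a) < s + d

balancedSizes-smallDiff : ∀ {s d r a} → d ≤ r + a → suc a + suc (r + a) ≤ s + d →
                          BalancedSizesStrictlyBetween s d r a
balancedSizes-smallDiff {s} {d} {r} {a} d≤r+a room = sizes , m≤m+n (suc a) 0 , overlapSize+r+a<s+d
  where
  1+a≤s : suc a ≤ s
  1+a≤s = +-cancelʳ-≤ (suc (r + a)) (suc a) s (begin
    suc a + suc (r + a)  ≤⟨ room ⟩
    s + d                ≤⟨ +-monoʳ-≤ s (m≤n⇒m≤1+n d≤r+a) ⟩
    s + suc (r + a)      ∎)
    where open ≤-Reasoning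
  s+d≤1+a+[r+s] : s + d ≤ suc a + (r + s)
  s+d≤1+a+[r+s] = begin
    s + d                ≤⟨ +-monoʳ-≤ s d≤r+a ⟩
    s + (r + a)          ≤⟨ n≤1+n _ ⟩
    suc (s + (r + a))    ≡⟨ cong suc (x∙yz≈z∙yx s r a) ⟩
    suc a + (r + s)      ∎
    where open ≤-Reasoning
  sizes : BalancedSizes s d r
  sizes = record
    { inBoth = suc a ; inEach = 0 ; inNeither = s + d ∸ suc a
    ; inBoth≤ = 1+a≤s ; inEach≤ = z≤n ; inNeither≤ = m≤n+o⇒m∸n≤o (s + d) (suc a) s+d≤1+a+[r+s]
    ; total = begin
        suc a + 0 + 0 + (s + d ∸ suc a)  ≡⟨ cong (_+ (s + d ∸ suc a)) (trans (+-identityʳ _) (+-identityʳ _)) ⟩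
        suc a + (s + d ∸ suc a)          ≡⟨ m+[n∸m]≡n (≤-trans 1+a≤s (m≤m+n s d)) ⟩
        s + d                            ∎
    }
    where open ≡-Reasoning
  overlapSize+r+a<s+d : suc a + 0 + (r + a) < s + d
  overlapSize+r+a<s+d = begin-strict
    suc a + 0 + (r + a)  ≡⟨ cong (_+ (r + a)) (+-identityʳ (suc a)) ⟩
    suc a + (r + a)      <⟨ +-monoʳ-< (suc a) (n<1+n (r + a)) ⟩
    suc a + suc (r + a)  ≤⟨ room ⟩
    s + d                ∎
    where open ≤-Reasoning

⌊n/2⌋+⌊n/2⌋≤n : ∀ n → ⌊ n /2⌋ + ⌊ n /2⌋ ≤ n
⌊n/2⌋+⌊n/2⌋≤n zero          = z≤n
⌊n/2⌋+⌊n/2⌋≤n (suc zero)    = z≤n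
⌊n/2⌋+⌊n/2⌋≤n (suc (suc n)) = s≤s (subst (_≤ suc n) (sym (+-suc ⌊ n /2⌋ ⌊ n /2⌋)) (s≤s (⌊n/2⌋+⌊n/2⌋≤n n)))

n≤1+⌊n/2⌋+⌊n/2⌋ : ∀ n → n ≤ suc (⌊ n /2⌋ + ⌊ n /2⌋)
n≤1+⌊n/2⌋+⌊n/2⌋ zero          = z≤n
n≤1+⌊n/2⌋+⌊n/2⌋ (suc zero)    = s≤s z≤n
n≤1+⌊n/2⌋+⌊n/2⌋ (suc (suc n)) = s≤s (subst (suc n ≤_) (cong suc (sym (+-suc ⌊ n /2⌋ ⌊ n /2⌋))) (s≤s (n≤1+⌊n/2⌋+⌊n/2⌋ n)))

balancedSizes-allOfBoth : ∀ {s r a g} e → e ≤ g → suc a ≤ s + e →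
  e + e ≤ suc (r + a) + g → suc (r + a) + g ≤ e + e + (r + s) →
  BalancedSizesStrictlyBetween s (suc (r + a) + g) r a
balancedSizes-allOfBoth {s} {r} {a} {g} e e≤g 1+a≤s+e 2e≤d d≤2e+[r+s] = sizes , 1+a≤s+e , s+e+r+a<s+d
  where
  d = suc (r + a) + g
  sizes : BalancedSizes s d r
  sizes = record
    { inBoth = s ; inEach = e ; inNeither = d ∸ (e + e)
    ; inBoth≤ = ≤-refl ; inEach≤ = ≤-trans (m≤m+n e e) 2e≤d ; inNeither≤ = m≤n+o⇒m∸n≤o d (e + e) d≤2e+[r+s]
    ; total = begin
        s + e + e + (d ∸ (e + e))      ≡⟨ +-assoc (s + e) e _ ⟩
        s + e + (e + (d ∸ (e + e)))    ≡⟨ +-assoc s e _ ⟩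
        s + (e + (e + (d ∸ (e + e))))  ≡⟨ cong (s +_) (+-assoc e e _) ⟨
        s + (e + e + (d ∸ (e + e)))    ≡⟨ cong (s +_) (m+[n∸m]≡n 2e≤d) ⟩
        s + d                          ∎
    }
    where open ≡-Reasoning
  s+e+r+a<s+d : s + e + (r + a) < s + d
  s+e+r+a<s+d = begin-strict
    s + e + (r + a)      ≡⟨ +-assoc s e (r + a) ⟩
    s + (e + (r + a))    ≡⟨ cong (s +_) (+-comm e (r + a)) ⟩
    s + (r + a + e)      <⟨ +-monoʳ-< s (n<1+n _) ⟩
    s + suc (r + a + e)  ≤⟨ +-monoʳ-≤ s (+-monoʳ-≤ (suc (r + a)) e≤g) ⟩
    s + d                ∎
    where open ≤-Reasoning

balancedSizes-halfOfDiff : ∀ {s r a} g → 1 ≤ r → ⌊ suc (r + a) + g /2⌋ ≤ g →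
                           BalancedSizesStrictlyBetween s (suc (r + a) + g) r a
balancedSizes-halfOfDiff {s} {r} {a} g 1≤r h≤g =
  balancedSizes-allOfBoth h h≤g 1+a≤s+h (⌊n/2⌋+⌊n/2⌋≤n d) d≤2h+[r+s]
  where
  open ≤-Reasoning
  d = suc (r + a) + g
  h = ⌊ d /2⌋
  r+a≤h : r + a ≤ h
  r+a≤h = +-cancelʳ-≤ h (r + a) h (≤-pred (begin
    suc (r + a + h)  ≤⟨ +-monoʳ-≤ (suc (r + a)) h≤g ⟩
    d                ≤⟨ n≤1+⌊n/2⌋+⌊n/2⌋ d ⟩
    suc (h + h)      ∎))
  1+a≤s+h : suc a ≤ s + h
  1+a≤s+h = ≤-trans (+-monoˡ-≤ a 1≤r) (≤-trans r+a≤h (m≤n+m h s))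
  d≤2h+[r+s] : d ≤ h + h + (r + s)
  d≤2h+[r+s] = begin
    d                ≤⟨ n≤1+⌊n/2⌋+⌊n/2⌋ d ⟩
    suc (h + h)      ≡⟨ +-comm 1 (h + h) ⟩
    h + h + 1        ≤⟨ +-monoʳ-≤ (h + h) (≤-trans 1≤r (m≤m+n r s)) ⟩
    h + h + (r + s)  ∎

balancedSizes-excessOfDiff : ∀ {s r a} g → suc a + suc (r + a) ≤ s + (suc (r + a) + g) →
                             g < ⌊ suc (r + a) + g /2⌋ → BalancedSizesStrictlyBetween s (suc (r + a) + g) r a
balancedSizes-excessOfDiff {s} {r} {a} g room g<h =
  balancedSizes-allOfBoth g ≤-refl 1+a≤s+g 2g≤d d≤2g+[r+s]
  where
  open ≤-Reasoning
  d = suc (r + a) + g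
  1+a≤s+g : suc a ≤ s + g
  1+a≤s+g = +-cancelʳ-≤ (suc (r + a)) (suc a) (s + g) (begin
    suc a + suc (r + a)  ≤⟨ room ⟩
    s + d                ≡⟨ x∙yz≈xz∙y s (suc (r + a)) g ⟩
    s + g + suc (r + a)  ∎)
  2g≤d : g + g ≤ d
  2g≤d = ≤-trans (+-mono-≤ (<⇒≤ g<h) (<⇒≤ g<h)) (⌊n/2⌋+⌊n/2⌋≤n d)
  d≤2g+[r+s] : d ≤ g + g + (r + s)
  d≤2g+[r+s] = begin
    suc (r + a) + g  ≡⟨ cong (_+ g) (+-suc r a) ⟨
    r + suc a + g    ≤⟨ +-monoˡ-≤ g (+-monoʳ-≤ r 1+a≤s+g) ⟩
    r + (s + g) + g  ≡⟨ cong (_+ g) (+-assoc r s g) ⟨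
    r + s + g + g    ≡⟨ +-assoc (r + s) g g ⟩
    r + s + (g + g)  ≡⟨ +-comm (r + s) (g + g) ⟩
    g + g + (r + s)  ∎

balancedSizes : ∀ {s d r a} → 1 ≤ r → suc a + suc (r + a) ≤ s + d → BalancedSizesStrictlyBetween s d r a
balancedSizes {s} {d} {r} {a} 1≤r room with d ≤? r + a
... | yes d≤r+a = balancedSizes-smallDiff d≤r+a room
... | no  d≰r+a with g , refl ← m≤n⇒∃[o]m+o≡n (≰⇒> d≰r+a) with ⌊ suc (r + a) + g /2⌋ ≤? g
...   | yes h≤g = balancedSizes-halfOfDiff g 1≤r h≤g
...   | no  h≰g = balancedSizes-excessOfDiff g room (≰⇒> h≰g)

module Kneser (k r : ℕ) where

  V : Set
  V = KVertex (2 * k + r) k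

  Adj : V → V → Set
  Adj = KAdj

  inter diff : V → V → ℕ
  inter x y = ∣ proj₁ x ∩ proj₁ y ∣
  diff  x y = ∣ proj₁ x ∩ ∁ (proj₁ y) ∣

  private
    variable
      x y : V

  proj₁-injective : proj₁ x ≡ proj₁ y → x ≡ y
  proj₁-injective {X , ∣X∣≡k} {.X , ∣X∣≡k′} refl = cong (X ,_) (≡-irrelevant ∣X∣≡k ∣X∣≡k′)

  inter+diff≡k : ∀ x y → inter x y + diff x y ≡ k
  inter+diff≡k (X , ∣X∣≡k) (Y , _) = trans (∣p∩q∣+∣p∩∁q∣≡∣p∣ X Y) ∣X∣≡k

  inter-comm : ∀ x y → inter x y ≡ inter y x
  inter-comm x y = cong ∣_∣ (∩-comm (proj₁ x) (proj₁ y))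

  diff-comm : ∀ x y → diff x y ≡ diff y x
  diff-comm x y = +-cancelˡ-≡ (inter x y) _ _ (begin
    inter x y + diff x y  ≡⟨ inter+diff≡k x y ⟩
    k                     ≡⟨ inter+diff≡k y x ⟨
    inter y x + diff y x  ≡⟨ cong (_+ diff y x) (inter-comm y x) ⟩
    inter x y + diff y x  ∎)
    where open ≡-Reasoning

  diff≤k : ∀ x y → diff x y ≤ k
  diff≤k x y = subst (diff x y ≤_) (inter+diff≡k x y) (m≤n+m (diff x y) (inter x y))

  ∣∁x∣≡k+r : ∀ x → ∣ ∁ (proj₁ x) ∣ ≡ k + r
  ∣∁x∣≡k+r (X , ∣X∣≡k) = begin
    ∣ ∁ X ∣            ≡⟨ ∣∁p∣≡n∸∣p∣ X ⟩
    2 * k + r ∸ ∣ X ∣  ≡⟨ cong (2 * k + r ∸_) {∣ X ∣} {k} ∣X∣≡k ⟩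
    2 * k + r ∸ k      ≡⟨ cong (λ m → k + m + r ∸ k) (+-identityʳ k) ⟩
    k + k + r ∸ k      ≡⟨ cong (_∸ k) (+-assoc k k r) ⟩
    k + (k + r) ∸ k    ≡⟨ m+n∸m≡n k (k + r) ⟩
    k + r              ∎
    where open ≡-Reasoning

  ∣∁x∩y∣≡diff : ∀ x y → ∣ ∁ (proj₁ x) ∩ proj₁ y ∣ ≡ diff x y
  ∣∁x∩y∣≡diff x y = trans (cong ∣_∣ (∩-comm (∁ (proj₁ x)) (proj₁ y))) (diff-comm y x)

  ∣∁x∩∁y∣≡r+inter : ∀ x y → ∣ ∁ (proj₁ x) ∩ ∁ (proj₁ y) ∣ ≡ r + inter x y
  ∣∁x∩∁y∣≡r+inter x y = +-cancelˡ-≡ (diff x y) _ _ (begin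
    diff x y + ∣ ∁X ∩ ∁ Y ∣       ≡⟨ cong (_+ ∣ ∁X ∩ ∁ Y ∣) (∣∁x∩y∣≡diff x y) ⟨
    ∣ ∁X ∩ Y ∣ + ∣ ∁X ∩ ∁ Y ∣     ≡⟨ ∣p∩q∣+∣p∩∁q∣≡∣p∣ ∁X Y ⟩
    ∣ ∁X ∣                        ≡⟨ ∣∁x∣≡k+r x ⟩
    k + r                         ≡⟨ cong (_+ r) (inter+diff≡k x y) ⟨
    inter x y + diff x y + r      ≡⟨ cong (_+ r) (+-comm (inter x y) (diff x y)) ⟩
    diff x y + inter x y + r      ≡⟨ +-assoc (diff x y) (inter x y) r ⟩
    diff x y + (inter x y + r)    ≡⟨ cong (diff x y +_) (+-comm (inter x y) r) ⟩
    diff x y + (r + inter x y)    ∎)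
    where
    open ≡-Reasoning
    ∁X = ∁ (proj₁ x)
    Y  = proj₁ y

  diff-self : ∀ x → diff x x ≡ 0
  diff-self (X , _) = trans (cong ∣_∣ (∩-inverseʳ X)) (∣⊥∣≡0 (2 * k + r))

  diff≡0⇒≡ : ∀ x y → diff x y ≡ 0 → x ≡ y
  diff≡0⇒≡ x y diff≡0 = proj₁-injective (⊆-antisym (⊆ x y diff≡0) (⊆ y x (trans (diff-comm y x) diff≡0)))
    where
    ⊆ : ∀ u v → diff u v ≡ 0 → proj₁ u ⊆ proj₁ v
    ⊆ u v = p∩∁q≡∅⇒p⊆q ∘ ∣p∣≡0⇒p≡∅ (proj₁ u ∩ ∁ (proj₁ v))

  inter≡0⇒Adj : ∀ x y → inter x y ≡ 0 → Adj x y
  inter≡0⇒Adj x y = ∣p∣≡0⇒p≡∅ (proj₁ x ∩ proj₁ y)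

  Adj⇒inter≡0 : ∀ x y → Adj x y → inter x y ≡ 0
  Adj⇒inter≡0 x y x~y = trans (cong ∣_∣ x~y) (∣⊥∣≡0 (2 * k + r))

  Adj⇒inter≤diff : ∀ x w y → Adj x w → inter x y ≤ diff w y
  Adj⇒inter≤diff x w y x~w = begin
    inter x y                    ≤⟨ p⊆q⇒∣p∣≤∣q∣ (p⊆q⇒p∩s⊆q∩s (p∩q≡∅⇒p⊆∁q x~w)) ⟩
    ∣ ∁ (proj₁ w) ∩ proj₁ y ∣    ≡⟨ ∣∁x∩y∣≡diff w y ⟩
    diff w y                     ∎
    where open ≤-Reasoning

  Adj⇒diff≤r+inter : ∀ x w y → Adj x w → diff x y ≤ r + inter w y
  Adj⇒diff≤r+inter x w y x~w = begin
    diff x y                         ≤⟨ p⊆q⇒∣p∣≤∣q∣ (p⊆q⇒p∩s⊆q∩s (p∩q≡∅⇒p⊆∁q x~w)) ⟩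
    ∣ ∁ (proj₁ w) ∩ ∁ (proj₁ y) ∣    ≡⟨ ∣∁x∩∁y∣≡r+inter w y ⟩
    r + inter w y                    ∎
    where open ≤-Reasoning

  neighbourWithInter : ∀ x y {c} → c ≤ diff x y → diff x y ≤ r + c → ∃ λ w → Adj x w × inter w y ≡ c
  neighbourWithInter x@(X , _) y@(Y , _) {c} c≤diff diff≤r+c =
    neighbour (selectByRegion X Y z≤n z≤n c≤∣∁X∩Y∣ k∸c≤∣∁X∩∁Y∣)
    where
    c≤k : c ≤ k
    c≤k = ≤-trans c≤diff (diff≤k x y)
    c≤∣∁X∩Y∣ : c ≤ ∣ ∁ X ∩ Y ∣
    c≤∣∁X∩Y∣ = subst (c ≤_) (sym (∣∁x∩y∣≡diff x y)) c≤diff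
    k∸c≤∣∁X∩∁Y∣ : k ∸ c ≤ ∣ ∁ X ∩ ∁ Y ∣
    k∸c≤∣∁X∩∁Y∣ = subst (k ∸ c ≤_) (sym (∣∁x∩∁y∣≡r+inter x y)) (m≤n+o⇒m∸n≤o k c (begin
      k                     ≡⟨ inter+diff≡k x y ⟨
      inter x y + diff x y  ≤⟨ +-monoʳ-≤ (inter x y) diff≤r+c ⟩
      inter x y + (r + c)   ≡⟨ x∙yz≈z∙yx (inter x y) r c ⟩
      c + (r + inter x y)   ∎))
      where open ≤-Reasoning
    neighbour : (∃ λ C → ∣ C ∣ ≡ c + (k ∸ c) × ∣ C ∩ X ∣ ≡ 0 × ∣ C ∩ Y ∣ ≡ c) → ∃ λ w → Adj x w × inter w y ≡ c
    neighbour (C , ∣C∣≡c+[k∸c] , ∣C∩X∣≡0 , ∣C∩Y∣≡c) =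
      (C , trans ∣C∣≡c+[k∸c] (m+[n∸m]≡n c≤k)) , ∣p∣≡0⇒p≡∅ (X ∩ C) (trans (cong ∣_∣ (∩-comm X C)) ∣C∩X∣≡0) , ∣C∩Y∣≡c

  neighbourWithDiff≡inter : ∀ x y → ∃ λ w → Adj x w × diff w y ≡ inter x y
  neighbourWithDiff≡inter x y with w , x~w , inter≡diff ← neighbourWithInter x y ≤-refl (m≤n+m (diff x y) r)
    = w , x~w , +-cancelˡ-≡ (inter w y) _ _ (begin
      inter w y + diff w y  ≡⟨ inter+diff≡k w y ⟩
      k                     ≡⟨ inter+diff≡k x y ⟨
      inter x y + diff x y  ≡⟨ +-comm (inter x y) (diff x y) ⟩
      diff x y + inter x y  ≡⟨ cong (_+ inter x y) inter≡diff ⟨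
      inter w y + inter x y ∎)
    where open ≡-Reasoning

  neighbourWithInter≡diff∸r : ∀ x y → ∃ λ w → Adj x w × inter w y ≡ diff x y ∸ r
  neighbourWithInter≡diff∸r x y = neighbourWithInter x y (m∸n≤m (diff x y) r) (m≤n+m∸n (diff x y) r)

  -- A walk of even length must bring |X ∖ Y| down to 0 and one of odd length |X ∩ Y|; two
  -- steps lower either quantity by at most r.
  gap : ℕ → V → V → ℕ
  gap zero          = diff
  gap (suc zero)    = inter
  gap (suc (suc m)) = gap m

  gap-twoSteps : ∀ m x w z y → Adj x w → Adj w z → gap m x y ≤ r + gap m z y
  gap-twoSteps zero x w z y x~w w~z =
    ≤-trans (Adj⇒diff≤r+inter x w y x~w) (+-monoʳ-≤ r (Adj⇒inter≤diff w z y w~z))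
  gap-twoSteps (suc zero) x w z y x~w w~z =
    ≤-trans (Adj⇒inter≤diff x w y x~w) (Adj⇒diff≤r+inter w z y w~z)
  gap-twoSteps (suc (suc m)) = gap-twoSteps m

  twoStepsReducingGap : ∀ m x y → ∃ λ z → Walk Adj 2 x z × gap m z y ≡ gap m x y ∸ r
  twoStepsReducingGap zero x y
    with w , x~w , inter≡diff∸r ← neighbourWithInter≡diff∸r x y
    with z , w~z , diff≡inter   ← neighbourWithDiff≡inter w y
    = z , cons {y = w} x~w (cons w~z nil) , trans diff≡inter inter≡diff∸r
  twoStepsReducingGap (suc zero) x y
    with w , x~w , diff≡inter   ← neighbourWithDiff≡inter x y
    with z , w~z , inter≡diff∸r ← neighbourWithInter≡diff∸r w y
    = z , cons {y = w} x~w (cons w~z nil) , trans inter≡diff∸r (cong (_∸ r) diff≡inter)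
  twoStepsReducingGap (suc (suc m)) = twoStepsReducingGap m

  walk⇒gap≤ : ∀ {m x y} → Walk Adj m x y → gap m x y ≤ ⌊ m /2⌋ * r
  walk⇒gap≤ {x = x} nil                    = ≤-reflexive (diff-self x)
  walk⇒gap≤ {x = x} {y} (cons x~y nil)     = ≤-reflexive (Adj⇒inter≡0 x y x~y)
  walk⇒gap≤ {suc (suc m)} {x} {y} (cons {y = w} x~w (cons {y = z} w~z walk)) =
    ≤-trans (gap-twoSteps m x w z y x~w w~z) (+-monoʳ-≤ r (walk⇒gap≤ walk))

  gap≤⇒walk : ∀ m x y → gap m x y ≤ ⌊ m /2⌋ * r → Walk Adj m x y
  gap≤⇒walk zero x y diff≤0 with refl ← diff≡0⇒≡ x y (n≤0⇒n≡0 diff≤0) = nil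
  gap≤⇒walk (suc zero) x y inter≤0 = cons (inter≡0⇒Adj x y (n≤0⇒n≡0 inter≤0)) nil
  gap≤⇒walk (suc (suc m)) x y gap≤
    with z , cons {y = w} x~w (cons w~z nil) , gap≡ ← twoStepsReducingGap m x y
    = cons {y = w} x~w (cons w~z (gap≤⇒walk m z y (subst (_≤ _) (sym gap≡) (m≤n+o⇒m∸n≤o _ r gap≤))))

  walk-pad : ∀ {m x y} → Walk Adj m x y → Walk Adj (suc (suc m)) x y
  walk-pad {m} {x} {y} walk = gap≤⇒walk (suc (suc m)) x y (≤-trans (walk⇒gap≤ walk) (m≤n+m _ r))

  gap-even : ∀ j x y → gap (j + j) x y ≡ diff x y
  gap-even zero    x y = refl
  gap-even (suc j) x y rewrite +-suc j j = gap-even j x y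

  gap-odd : ∀ j x y → gap (suc (j + j)) x y ≡ inter x y
  gap-odd zero    x y = refl
  gap-odd (suc j) x y rewrite +-suc j j = gap-odd j x y

  ¬walk⇔gap> : ∀ m x y → (¬ Walk Adj m x y) ⇔ (⌊ m /2⌋ * r < gap m x y)
  ¬walk⇔gap> m x y = mk⇔ (λ ¬walk → ≰⇒> (¬walk ∘ gap≤⇒walk m x y)) (λ gap> → <⇒≱ gap> ∘ walk⇒gap≤)

  Far : ℕ → V → V → Set
  Far a x y = a < inter x y × r + a < diff x y

  noShortWalks⇔Far : ∀ q x y →
    (¬ Walk Adj (suc (q + q)) x y × ¬ Walk Adj (suc (suc (q + q))) x y) ⇔ Far (q * r) x y
  noShortWalks⇔Far q x y = noOddWalk ×-⇔ noEvenWalk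
    where
    noOddWalk : (¬ Walk Adj (suc (q + q)) x y) ⇔ (q * r < inter x y)
    noOddWalk = subst₂ (λ h g → (¬ Walk Adj (suc (q + q)) x y) ⇔ (h * r < g))
                       (sym (n≡⌈n+n/2⌉ q)) (gap-odd q x y) (¬walk⇔gap> (suc (q + q)) x y)
    noEvenWalk : (¬ Walk Adj (suc (suc (q + q))) x y) ⇔ (suc q * r < diff x y)
    noEvenWalk = subst₂ (λ h g → (¬ Walk Adj (suc (suc (q + q))) x y) ⇔ (suc h * r < g))
                        (sym (n≡⌊n+n/2⌋ q)) (gap-even q x y) (¬walk⇔gap> (suc (suc (q + q))) x y)

  Far⇒room : ∀ {a} x y → Far a x y → suc a + suc (r + a) ≤ k
  Far⇒room x y (a<inter , r+a<diff) = subst (_ ≤_) (inter+diff≡k x y) (+-mono-≤ a<inter r+a<diff)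

  balancedVertex : ∀ x y (sizes : BalancedSizes (inter x y) (diff x y) r) →
                   ∃ λ z → inter z x ≡ overlapSize sizes × inter z y ≡ overlapSize sizes
  balancedVertex x@(X , _) y@(Y , _) sizes with C , ∣C∣≡ , ∣C∩X∣≡ , ∣C∩Y∣≡ ←
    selectByRegion X Y (inBoth≤ sizes) (inEach≤ sizes)
      (subst (inEach sizes ≤_) (sym (∣∁x∩y∣≡diff x y)) (inEach≤ sizes))
      (subst (inNeither sizes ≤_) (sym (∣∁x∩∁y∣≡r+inter x y)) (inNeither≤ sizes))
    = (C , trans ∣C∣≡ (trans (total sizes) (inter+diff≡k x y))) , ∣C∩X∣≡ , ∣C∩Y∣≡

  midpoint : ∀ a → 1 ≤ r → suc a + suc (r + a) ≤ k → ∀ x y → ∃ λ z → Far a x z × Far a z y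
  midpoint a 1≤r room x y
    with sizes , a<t , t+r+a<k ← balancedSizes 1≤r (subst (_ ≤_) (sym (inter+diff≡k x y)) room)
    with z , ∣z∩x∣≡t , ∣z∩y∣≡t ← balancedVertex x y sizes
    = z , far x z (trans (inter-comm x z) ∣z∩x∣≡t) , far z y ∣z∩y∣≡t
    where
    t = overlapSize sizes
    far : ∀ u v → inter u v ≡ t → Far a u v
    far u v inter≡t = subst (a <_) (sym inter≡t) a<t , +-cancelˡ-< t (r + a) (diff u v) (begin-strict
      t + (r + a)           <⟨ t+r+a<k ⟩
      inter x y + diff x y  ≡⟨ inter+diff≡k x y ⟩
      k                     ≡⟨ inter+diff≡k u v ⟨
      inter u v + diff u v  ≡⟨ cong (_+ diff u v) inter≡t ⟩
      t + diff u v          ∎)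
      where open ≤-Reasoning

  module _ (q : ℕ) where

    D : ℕ
    D = suc (suc (suc (q + q)))

    Dist⇒Far : ∀ x y → Dist Adj x y D → Far (q * r) x y
    Dist⇒Far x y (_ , shorter) =
      Equivalence.to (noShortWalks⇔Far q x y) (shorter _ (m<n⇒m<1+n (n<1+n _)) , shorter _ (n<1+n _))

    Far⇒Dist : ∀ x y → (∃ λ m → m ≤ D × Dist Adj x y m) → Far (q * r) x y → Dist Adj x y D
    Far⇒Dist x y (m , m≤D , walk , _) far
      with ¬oddWalk , ¬evenWalk ← Equivalence.from (noShortWalks⇔Far q x y) far
      = walk≤∧noWalks⇒Dist walk-pad m≤D walk ¬oddWalk ¬evenWalk

2[1+q]+1≡3+[q+q] : ∀ q → 2 * suc q + 1 ≡ suc (suc (suc (q + q)))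
2[1+q]+1≡3+[q+q] = solve-∀

mainTheorem11 : (k r p : ℕ) → 2 ≤ k → 1 ≤ r → r < k ∸ 1 → ¬ (r ∣ k ∸ 1) → 1 ≤ p
    → Diameter (KAdj {2 * k + r} {k}) (2 * p + 1)
    → (A B : KVertex (2 * k + r) k) → ¬ (A ≡ B)
    → ¬ ExactDistAdj (KAdj {2 * k + r} {k}) (2 * p + 1) A B
    → Dist (ExactDistAdj (KAdj {2 * k + r} {k}) (2 * p + 1)) A B 2
mainTheorem11 k r zero _ _ _ _ ()
mainTheorem11 k r (suc q) _ 1≤r _ _ _ rewrite 2[1+q]+1≡3+[q+q] q =
  λ (eccentricity≤D , x₀ , y₀ , x₀y₀-far) A B A≢B A≁B →
    let C , A⋯C , C⋯B = midpoint (q * r) 1≤r (Far⇒room x₀ y₀ (Dist⇒Far q x₀ y₀ x₀y₀-far)) A B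
    in Dist-two A≢B A≁B (Far⇒Dist q A C (eccentricity≤D A C) A⋯C) (Far⇒Dist q C B (eccentricity≤D C B) C⋯B)
  where open Kneser k r
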